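{- For all points $A,B,C$: $\mathrm{Bet}(A,B,C)$ holds if and only if ($B$ and $C$ lie on the same half-line from $A$) and ($B$ and $A$ lie on the same half-line from $C$).
   Context: Synthetic plane geometry with classical logic. Primitive notions: points, lines (with equality), incidence $A\in x$, a ternary betweenness relation $\mathrm{Bet}(A,B,C)$ on points ("$B$ strictly between $A$ and $C$"), lengths with a map $(A,B)\mapsto|AB|$. Points are collinear if some line contains all of them. Axioms: (incidence) there is a point; for every point there is a distinct point; every line has a point; for every line $x$ and $A\in x$ there is $B\in x$, $B\neq A$; for every line there is a point not on it; through two distinct points there is a line; if $A\neq B$, $A,B\in x$ and $x\neq y$ then $A\notin y$ or $B\notin y$. (betweenness) if $\mathrm{Bet}(A,B,C)$ then $A\neq C$, $A,B,C$ are collinear, $\mathrm{Bet}(C,B,A)$, and not $\mathrm{Bet}(B,A,C)$. (lengths) $|AB|=|CC|$ iff $A=B$; $|AB|=|BA|$. (line–circle) for $O,A,B$ with $A\neq O$ there is $C$ with ($\mathrm{Bet}(A,O,C)$ or $O=C$) and $|OB|=|OC|$. "$A,B$ lie on opposite sides of line $x$": $A,B\notin x$ and some $O\in x$ has $\mathrm{Bet}(A,O,B)$. (Pasch) if $A,B$ lie on opposite sides of $x$ and $C\notin x$, then $A,C$ or $C,B$ lie on opposite sides of $x$. Definition: "$P$ and $Q$ lie on the same half-line from $O$" means $O\neq P$, $O\neq Q$, $O,P,Q$ are collinear, and not $\mathrm{Bet}(P,O,Q)$. -}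

module Defs where

open import Level using (0ℓ)
open import Data.Product using (Σ; ∃; _×_; _,_)
open import Data.Sum using (_⊎_)
open import Relation.Nullary using (¬_)
open import Relation.Binary.PropositionalEquality using (_≡_; _≢_)

record Geometry : Set₁ where
  field
    Point  : Set
    Line   : Set
    Length : Set
    _∈_    : Point → Line → Set
    Bet    : Point → Point → Point → Set
    ∣_,_∣  : Point → Point → Length

  _∉_ : Point → Line → Set
  A ∉ x = ¬ (A ∈ x)

  Collinear : Point → Point → Point → Set
  Collinear A B C = Σ Line λ x → A ∈ x × B ∈ x × C ∈ x

  OppositeSides : Point → Point → Line → Set
  OppositeSides A B x = A ∉ x × B ∉ x × Σ Point λ O → O ∈ x × Bet A O B

  field
    ax-point      : Point
    ax-other      : ∀ (A : Point) → Σ Point λ B → B ≢ A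
    ax-line-point : ∀ (x : Line) → Σ Point λ A → A ∈ x
    ax-line-two   : ∀ (x : Line) (A : Point) → A ∈ x → Σ Point λ B → B ∈ x × B ≢ A
    ax-line-out   : ∀ (x : Line) → Σ Point λ A → A ∉ x
    ax-join       : ∀ (A B : Point) → A ≢ B → Σ Line λ x → A ∈ x × B ∈ x
    ax-unique     : ∀ (A B : Point) (x y : Line) → A ≢ B → A ∈ x → B ∈ x → x ≢ y →
                    A ∉ y ⊎ B ∉ y
    bet-neq       : ∀ {A B C} → Bet A B C → A ≢ C
    bet-col       : ∀ {A B C} → Bet A B C → Collinear A B C
    bet-sym       : ∀ {A B C} → Bet A B C → Bet C B A
    bet-not       : ∀ {A B C} → Bet A B C → ¬ Bet B A C
    len-zero      : ∀ (A B C : Point) → (∣ A , B ∣ ≡ ∣ C , C ∣ → A ≡ B) × (A ≡ B → ∣ A , B ∣ ≡ ∣ C , C ∣)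
    len-sym       : ∀ (A B : Point) → ∣ A , B ∣ ≡ ∣ B , A ∣
    line-circle   : ∀ (O A B : Point) → A ≢ O →
                    Σ Point λ C → (Bet A O C ⊎ O ≡ C) × ∣ O , B ∣ ≡ ∣ O , C ∣
    pasch         : ∀ (A B C : Point) (x : Line) → OppositeSides A B x → C ∉ x →
                    OppositeSides A C x ⊎ OppositeSides C B x

  SameHalfLine : Point → Point → Point → Set
  SameHalfLine O P Q = O ≢ P × O ≢ Q × Collinear O P Q × ¬ Bet P O Q

-- The forward direction is immediate from the betweenness axioms. Conversely, A, B, C are
-- distinct points of a line a and neither A nor C lies between the other two.
-- Choose D off a and F with Bet B D F. Because A is not between B and C, Pasch for
-- the line AD shows that C and F are on opposite sides of AD, say Bet C E F with E on
-- AD; likewise A and F are on opposite sides of CD. The point E lies between C and F,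
-- so A and E are on opposite sides of CD, which forces Bet A D E. Then A and E, hence
-- A and C (C lies beyond E seen from F), are on opposite sides of the line BD, and
-- the segment AC meets BD in B.
module Submission where

open import Defs
open import Level using (0ℓ)
open import Data.Product using (_×_; _,_; Σ; proj₁)
open import Data.Sum using (inj₁; inj₂)
open import Data.Empty using (⊥-elim)
open import Function.Bundles using (_⇔_; mk⇔)
open import Axiom.ExcludedMiddle using (ExcludedMiddle)
open import Relation.Nullary using (¬_; yes; no)
open import Relation.Binary.PropositionalEquality using (_≡_; _≢_; refl; sym; subst; ≢-sym)

module _ (G : Geometry) where
  open Geometry G

  ∈∉⇒≢ : ∀ {P Q x} → P ∈ x → Q ∉ x → P ≢ Q
  ∈∉⇒≢ P∈x Q∉x refl = Q∉x P∈x

  line-≢ : ∀ {P x y} → P ∈ x → P ∉ y → x ≢ y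
  line-≢ P∈x P∉y refl = P∉y P∈x

  bet-≢₁₂ : ∀ {P Q R} → Bet P Q R → P ≢ Q
  bet-≢₁₂ PQR refl = bet-not PQR PQR

  bet⇒sameHalfLine : ∀ {A B C} → Bet A B C → SameHalfLine A B C
  bet⇒sameHalfLine ABC = bet-≢₁₂ ABC , bet-neq ABC , bet-col ABC , bet-not ABC

  bet-extend : ∀ {P O} → P ≢ O → Σ Point λ R → Bet P O R
  bet-extend {P} {O} P≢O with line-circle O P P P≢O
  ... | R , inj₁ POR , _       = R , POR
  ... | R , inj₂ refl , OP≡OO = ⊥-elim (P≢O (sym (proj₁ (len-zero O P O) OP≡OO)))

  module _ (em : ExcludedMiddle 0ℓ) where

    line-unique : ∀ {P Q x y} → P ≢ Q → P ∈ x → Q ∈ x → P ∈ y → Q ∈ y → x ≡ y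
    line-unique {P} {Q} {x} {y} P≢Q P∈x Q∈x P∈y Q∈y with em {x ≡ y}
    ... | yes x≡y = x≡y
    ... | no x≢y with ax-unique P Q x y P≢Q P∈x Q∈x x≢y
    ...   | inj₁ P∉y = ⊥-elim (P∉y P∈y)
    ...   | inj₂ Q∉y = ⊥-elim (Q∉y Q∈y)

    intersection-unique : ∀ {P Q x y} → P ∈ x → Q ∈ x → P ∈ y → Q ∈ y → x ≢ y → P ≡ Q
    intersection-unique {P} {Q} P∈x Q∈x P∈y Q∈y x≢y with em {P ≡ Q}
    ... | yes P≡Q = P≡Q
    ... | no P≢Q = ⊥-elim (x≢y (line-unique P≢Q P∈x Q∈x P∈y Q∈y))

    bet-∈ : ∀ {P Q R z} → Bet P Q R → P ∈ z → R ∈ z → Q ∈ z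
    bet-∈ PQR P∈z R∈z with bet-col PQR
    ... | y , P∈y , Q∈y , R∈y = subst (_ ∈_) (line-unique (bet-neq PQR) P∈y R∈y P∈z R∈z) Q∈y

    ∉-of-crossing : ∀ {P Q R x y} → P ≢ Q → P ∈ x → Q ∈ x → Q ∈ y → R ∈ y → R ∉ x → P ∉ y
    ∉-of-crossing P≢Q P∈x Q∈x Q∈y R∈y R∉x P∈y =
      R∉x (subst (_ ∈_) (line-unique P≢Q P∈y Q∈y P∈x Q∈x) R∈y)

    bet-∉₂ : ∀ {P Q R x} → Bet P Q R → P ∈ x → R ∉ x → Q ∉ x
    bet-∉₂ PQR P∈x R∉x Q∈x with bet-col PQR
    ... | y , P∈y , Q∈y , R∈y = R∉x (subst (_ ∈_) (line-unique (bet-≢₁₂ PQR) P∈y Q∈y P∈x Q∈x) R∈y)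

    bet-∉₃ : ∀ {P Q R x} → Bet P Q R → P ∈ x → Q ∉ x → R ∉ x
    bet-∉₃ PQR P∈x Q∉x R∈x = Q∉x (bet-∈ PQR P∈x R∈x)

    -- S lies on the line PQR, and S ≠ P because P cannot lie between Q and R.
    bet-segment-∉ : ∀ {P Q R S x} → Bet P Q R → P ∈ x → R ∉ x → Bet Q S R → S ∉ x
    bet-segment-∉ {P} {S = S} PQR P∈x R∉x QSR S∈x with em {P ≡ S}
    ... | yes refl = bet-not PQR QSR
    ... | no P≢S with bet-col PQR
    ...   | y , P∈y , Q∈y , R∈y =
      R∉x (subst (_ ∈_) (line-unique P≢S P∈y (bet-∈ QSR Q∈y R∈y) P∈x S∈x) R∈y)

    crossing-is-meet : ∀ {P Q O x y} → OppositeSides P Q x → P ∈ y → Q ∈ y → O ∈ x → O ∈ y →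
                       x ≢ y → Bet P O Q
    crossing-is-meet (_ , _ , X , X∈x , PXQ) P∈y Q∈y O∈x O∈y x≢y =
      subst (λ X → Bet _ X _) (intersection-unique X∈x O∈x (bet-∈ PXQ P∈y Q∈y) O∈y x≢y) PXQ

    opposite-sides-inner : ∀ {A Q R O x} → OppositeSides A Q x → O ∈ x → Bet O R Q →
                           OppositeSides A R x
    opposite-sides-inner {A} {Q} {R} {x = x} A∣Q@(_ , Q∉x , _) O∈x ORQ
      with pasch A Q R x A∣Q (bet-∉₂ ORQ O∈x Q∉x)
    ... | inj₁ A∣R = A∣R
    ... | inj₂ (_ , _ , S , S∈x , RSQ) = ⊥-elim (bet-segment-∉ ORQ O∈x Q∉x RSQ S∈x)

    opposite-sides-outer : ∀ {A Q R O x} → OppositeSides A Q x → O ∈ x → Bet O Q R →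
                           OppositeSides A R x
    opposite-sides-outer {A} {Q} {R} {x = x} A∣Q@(_ , Q∉x , _) O∈x OQR
      with pasch A Q R x A∣Q (bet-∉₃ OQR O∈x Q∉x)
    ... | inj₁ A∣R = A∣R
    ... | inj₂ (R∉x , _ , S , S∈x , RSQ) = ⊥-elim (bet-segment-∉ OQR O∈x R∉x (bet-sym RSQ) S∈x)

    -- Pasch, where P and R cannot be separated by x because the line PR meets x only in O.
    opposite-sides-unseparated : ∀ {P Q R O x y} → OppositeSides P Q x → R ∉ x →
                                 P ∈ y → R ∈ y → O ∈ x → O ∈ y → x ≢ y → ¬ Bet P O R →
                                 OppositeSides R Q x
    opposite-sides-unseparated {P} {Q} {R} {x = x} P∣Q R∉x P∈y R∈y O∈x O∈y x≢y ¬POR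
      with pasch P Q R x P∣Q R∉x
    ... | inj₁ P∣R = ⊥-elim (¬POR (crossing-is-meet P∣R P∈y R∈y O∈x O∈y x≢y))
    ... | inj₂ R∣Q = R∣Q

    sameHalfLines⇒bet : ∀ {A B C} → SameHalfLine A B C → SameHalfLine C B A → Bet A B C
    sameHalfLines⇒bet {A} {B} {C} (A≢B , A≢C , (a , A∈a , B∈a , C∈a) , ¬BAC) (C≢B , _ , _ , ¬BCA)
      with ax-line-out a
    ... | D , D∉a with bet-extend (∈∉⇒≢ B∈a D∉a)
    ... | F , BDF with bet-col BDF | ax-join A D (∈∉⇒≢ A∈a D∉a) | ax-join C D (∈∉⇒≢ C∈a D∉a)
    ... | l , B∈l , D∈l , F∈l | m , A∈m , D∈m | n , C∈n , D∈n = across-AD C∣F-AD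
      where
      F≢D : F ≢ D
      F≢D = bet-≢₁₂ (bet-sym BDF)

      A∉l : A ∉ l
      A∉l = ∉-of-crossing A≢B A∈a B∈a B∈l D∈l D∉a
      C∉l : C ∉ l
      C∉l = ∉-of-crossing C≢B C∈a B∈a B∈l D∈l D∉a
      B∉m : B ∉ m
      B∉m = ∉-of-crossing (≢-sym A≢B) B∈a A∈a A∈m D∈m D∉a
      C∉m : C ∉ m
      C∉m = ∉-of-crossing (≢-sym A≢C) C∈a A∈a A∈m D∈m D∉a
      F∉m : F ∉ m
      F∉m = ∉-of-crossing F≢D F∈l D∈l D∈m A∈m A∉l
      A∉n : A ∉ n
      A∉n = ∉-of-crossing A≢C A∈a C∈a C∈n D∈n D∉a
      B∉n : B ∉ n
      B∉n = ∉-of-crossing (≢-sym C≢B) B∈a C∈a C∈n D∈n D∉a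
      F∉n : F ∉ n
      F∉n = ∉-of-crossing F≢D F∈l D∈l D∈n C∈n C∉l

      C∣F-AD : OppositeSides C F m
      C∣F-AD = opposite-sides-unseparated (B∉m , F∉m , D , D∈m , BDF) C∉m
                 B∈a C∈a A∈m A∈a (line-≢ D∈m D∉a) ¬BAC

      A∣F-CD : OppositeSides A F n
      A∣F-CD = opposite-sides-unseparated (B∉n , F∉n , D , D∈n , BDF) A∉n
                 B∈a A∈a C∈n C∈a (line-≢ D∈n D∉a) ¬BCA

      across-AD : OppositeSides C F m → Bet A B C
      across-AD (_ , _ , E , E∈m , CEF) =
        crossing-is-meet A∣C-BD A∈a C∈a B∈l B∈a (line-≢ D∈l D∉a)
        where
        ADE : Bet A D E
        ADE = crossing-is-meet (opposite-sides-inner A∣F-CD C∈n CEF)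
                A∈m E∈m D∈n D∈m (line-≢ C∈n C∉m)

        A∣C-BD : OppositeSides A C l
        A∣C-BD = opposite-sides-outer (A∉l , bet-∉₂ (bet-sym CEF) F∈l C∉l , D , D∈l , ADE)
                   F∈l (bet-sym CEF)

theorem7 : (G : Geometry) → ExcludedMiddle 0ℓ → let open Geometry G in
    ∀ (A B C : Point) → Bet A B C ⇔ (SameHalfLine A B C × SameHalfLine C B A)
theorem7 G em A B C = mk⇔
  (λ ABC → bet⇒sameHalfLine G ABC , bet⇒sameHalfLine G (Geometry.bet-sym G ABC))
  (λ (ABC , CBA) → sameHalfLines⇒bet G em ABC CBA)
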